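{- For every $n\in\omega$ and all finite tuples $d,a$ from $N$: $\mathrm{rk}(d/a)\ge n$ if and only if there is a chain $M_0\preceq M_1\preceq\cdots\preceq M_n=N$ with $a\subseteq M_0$ and $\mathrm{pcl}(M_i d)\cap(M_{i+1}\setminus M_i)\neq\emptyset$ for all $i<n$.
   Context: $T$ is a complete first-order theory in a countable language, $N$ a countable atomic model of $T$ that is not minimal. For finite tuples, $d\in\mathrm{pcl}(a)$ means every $M\preceq N$ containing $a$ contains $d$; for $A\subseteq N$, $\mathrm{pcl}(A)=\bigcup\{\mathrm{pcl}(a):a\subseteq A\text{ finite}\}$ and $\mathrm{pcl}(Ad)=\mathrm{pcl}(A\cup d)$. $S_{at}(a)$ is the set of complete types over $a$ realized in $N$. Rank: $\mathrm{rk}(d/a)\ge0$ always; for $\alpha>0$, $\mathrm{rk}(d/a)\ge\alpha$ iff for every $r\in S_{at}(a)$ and $\beta<\alpha$ there are finite $a',b,c$ from $N$ with $\mathrm{tp}(a'/a)=r$, $\mathrm{rk}(d/aa'bc)\ge\beta$, $c\in\mathrm{pcl}(daa'b)\setminus\mathrm{pcl}(aa'b)$. -}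

module Defs where

open import Data.Nat using (ℕ; zero; suc; _+_)
open import Data.Fin using (Fin; zero; suc; toℕ; fromℕ; inject₁; inject≤)
open import Data.Fin.Properties using (toℕ≤pred[n])
open import Data.Vec using (Vec; []; _∷_; map; lookup; fromList; toList; _++_)
open import Data.List using (List; length) renaming (_++_ to _++ˡ_; [_] to [_]ˡ)
open import Data.List.Relation.Unary.All using (All)
open import Data.List.Membership.Propositional using (_∈_)
open import Data.Product using (Σ; ∃; ∃₂; _×_; _,_; proj₁)
open import Data.Sum using (_⊎_)
open import Data.Unit using (⊤)
open import Data.Empty using (⊥)
open import Relation.Nullary using (¬_)
open import Relation.Binary.PropositionalEquality using (_≡_)
open import Function using (_⇔_; _∘_)
open import Function.Definitions using (Injective)

record Language : Set₁ where
  field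
    Fun    : Set
    Rel    : Set
    funAr  : Fun → ℕ
    relAr  : Rel → ℕ
    funCode    : Fun → ℕ
    funCodeInj : Injective _≡_ _≡_ funCode
    relCode    : Rel → ℕ
    relCodeInj : Injective _≡_ _≡_ relCode

module _ (L : Language) where
  open Language L

  record Structure : Set₁ where
    field
      Carrier : Set
      funI    : (f : Fun) → Vec Carrier (funAr f) → Carrier
      relI    : (R : Rel) → Vec Carrier (relAr R) → Set

  data Term (n : ℕ) : Set where
    var : Fin n → Term n
    app : (f : Fun) → Vec (Term n) (funAr f) → Term n

  data Formula (n : ℕ) : Set where
    ⊤ᶠ ⊥ᶠ : Formula n
    _≐_   : Term n → Term n → Formula n
    rel   : (R : Rel) → Vec (Term n) (relAr R) → Formula n
    ¬ᶠ_   : Formula n → Formula n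
    _∧ᶠ_ _∨ᶠ_ _⇒ᶠ_ : Formula n → Formula n → Formula n
    ∀ᶠ ∃ᶠ : Formula (suc n) → Formula n

module _ {L : Language} (S : Structure L) where
  open Language L
  open Structure S

  extend : ∀ {n} → Carrier → (Fin n → Carrier) → Fin (suc n) → Carrier
  extend x ρ zero    = x
  extend x ρ (suc i) = ρ i

  mutual
    eval : ∀ {n} → (Fin n → Carrier) → Term L n → Carrier
    eval ρ (var i)    = ρ i
    eval ρ (app f ts) = funI f (evalVec ρ ts)

    evalVec : ∀ {n k} → (Fin n → Carrier) → Vec (Term L n) k → Vec Carrier k
    evalVec ρ []       = []
    evalVec ρ (t ∷ ts) = eval ρ t ∷ evalVec ρ ts

  Sat : ∀ {n} → Formula L n → (Fin n → Carrier) → Set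
  Sat ⊤ᶠ         ρ = ⊤
  Sat ⊥ᶠ         ρ = ⊥
  Sat (s ≐ t)    ρ = eval ρ s ≡ eval ρ t
  Sat (rel R ts) ρ = relI R (evalVec ρ ts)
  Sat (¬ᶠ φ)     ρ = ¬ Sat φ ρ
  Sat (φ ∧ᶠ ψ)   ρ = Sat φ ρ × Sat ψ ρ
  Sat (φ ∨ᶠ ψ)   ρ = Sat φ ρ ⊎ Sat ψ ρ
  Sat (φ ⇒ᶠ ψ)   ρ = Sat φ ρ → Sat ψ ρ
  Sat (∀ᶠ φ)     ρ = ∀ x → Sat φ (extend x ρ)
  Sat (∃ᶠ φ)     ρ = Σ Carrier λ x → Sat φ (extend x ρ)


module _ {L : Language} (S : Structure L) where
  open Language L
  open Structure S

  Subset : Set₁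
  Subset = Carrier → Set

  Closed : Subset → Set
  Closed M = ∀ (f : Fun) (xs : Vec Carrier (funAr f)) →
             (∀ i → M (lookup xs i)) → M (funI f xs)

  -- membership is proof-irrelevant, so the carrier Σ Carrier M is a subset
  PropSubset : Subset → Set
  PropSubset M = ∀ x (p q : M x) → p ≡ q

  liftVec : (M : Subset) → ∀ {k} → Vec (Σ Carrier M) k → Vec Carrier k
  liftVec M = map proj₁

  lookup-liftVec : (M : Subset) → ∀ {k} (xs : Vec (Σ Carrier M) k) (i : Fin k) →
                   M (lookup (liftVec M xs) i)
  lookup-liftVec M (x ∷ xs) zero    = Data.Product.proj₂ x
  lookup-liftVec M (x ∷ xs) (suc i) = lookup-liftVec M xs i

  induced : (M : Subset) → Closed M → Structure L
  induced M cl = record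
    { Carrier = Σ Carrier M
    ; funI    = λ f xs → funI f (liftVec M xs) , cl f (liftVec M xs) (lookup-liftVec M xs)
    ; relI    = λ R xs → relI R (liftVec M xs)
    }

  record Elementary (M : Subset) : Set₁ where
    field
      propM  : PropSubset M
      closed : Closed M
      elem   : ∀ {n} (φ : Formula L n) (ρ : Fin n → Σ Carrier M) →
               Sat (induced M closed) φ ρ ⇔ Sat S φ (proj₁ ∘ ρ)

  Countable : Set
  Countable = Σ (Carrier → ℕ) λ f → Injective _≡_ _≡_ f

  -- atomic (T = Th(S) is complete): every finite tuple realises an
  -- isolated (principal) type, isolated by a formula φ
  Atomic : Set
  Atomic = ∀ {n} (v : Vec Carrier n) → Σ (Formula L n) λ φ →
           Sat S φ (lookup v) ×
           (∀ (ψ : Formula L n) →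
              (∀ ρ → Sat S φ ρ → Sat S ψ ρ) ⊎ (∀ ρ → Sat S φ ρ → ¬ Sat S ψ ρ))

  Minimal : Set₁
  Minimal = ¬ (Σ Subset λ M → Elementary M × Σ Carrier λ x → ¬ M x)

  Pcl : List Carrier → List Carrier → Set₁
  Pcl d a = ∀ (M : Subset) → Elementary M → All M a → All M d

  PclSet : Subset → List Carrier → Carrier → Set₁
  PclSet A d e = ∃ λ (b : List Carrier) → All (λ x → A x ⊎ x ∈ d) b × Pcl [ e ]ˡ b

  SameType : ∀ {k} → Vec Carrier k → Vec Carrier k → List Carrier → Set
  SameType {k} x y a = ∀ (φ : Formula L (k + length a)) →
    Sat S φ (lookup (x ++ fromList a)) ⇔ Sat S φ (lookup (y ++ fromList a))

  RkStep : (m : ℕ) → (Fin m → List Carrier → List Carrier → Set₁) →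
           List Carrier → List Carrier → Set₁
  RkStep m lower d a =
    ∀ {k} (e : Vec Carrier k) (β : Fin m) →
    ∃ λ (a' : Vec Carrier k) → ∃₂ λ (b c : List Carrier) →
      SameType a' e a ×
      lower β d (a ++ˡ toList a' ++ˡ b ++ˡ c) ×
      Pcl c (d ++ˡ a ++ˡ toList a' ++ˡ b) ×
      ¬ Pcl c (a ++ˡ toList a' ++ˡ b)

  -- RkF n β d a  means  rk(d/a) ≥ toℕ β   (for β < n)
  RkF : (n : ℕ) → Fin n → List Carrier → List Carrier → Set₁
  RkF (suc n) β = RkStep (toℕ β) (λ γ → RkF n (inject≤ γ (toℕ≤pred[n] β)))

  Rk : ℕ → List Carrier → List Carrier → Set₁
  Rk n = RkF (suc n) (fromℕ n)

  GoodChain : ℕ → List Carrier → List Carrier → Set₁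
  GoodChain n d a = Σ (Fin (suc n) → Subset) λ Ms →
    (∀ i → Elementary (Ms i)) ×
    (∀ (i : Fin n) x → Ms (inject₁ i) x → Ms (suc i) x) ×
    (∀ x → Ms (fromℕ n) x) ×
    All (Ms zero) a ×
    (∀ (i : Fin n) → ∃ λ e → PclSet (Ms (inject₁ i)) d e × Ms (suc i) e × ¬ Ms (inject₁ i) e)

-- (⇒) A witness c ∈ pcl(dab) ∖ pcl(ab) for rk(d/a) ≥ n+1, together with a chain
-- M₀ ⪯ … ⪯ Mₙ = N for rk(d/abc) ≥ n, gives a model M ⪯ N containing ab but not
-- some x ∈ c.  Since N is countable and atomic and M₀ ⪯ N contains abc, N embeds
-- elementarily into M₀ over abc.  The image M′ of M is again a model, lies in M₀,
-- contains ab and misses x, so x ∈ pcl(M′ d) ∩ (M₀ ∖ M′): putting M′ in front of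
-- the chain lengthens it.
--
-- (⇐) Given a chain and a type r over a, realise r by a' in M₀ (M₀ ⪯ N and r is
-- isolated).  The element e ∈ pcl(M₀ d) ∩ (M₁ ∖ M₀) lies in pcl(d a a' b) for some
-- b ⊆ M₀ but not in pcl(a a' b) ⊆ M₀, and the chain from M₁ on witnesses the lower
-- rank over a a' b e.

module Submission where

open import Defs
open import Level using (0ℓ; Lift; lift)
open import Axiom.ExcludedMiddle using (ExcludedMiddle)
open import Axiom.UniquenessOfIdentityProofs.WithK using (uip)
open import Data.Nat using (ℕ; zero; suc; _+_; _≤_; _⊔_; _≤′_; ≤′-reflexive; ≤′-step; z≤n; s≤s)
open import Data.Nat.Properties using (≤-trans; ≤⇒≤′; m≤m⊔n; m≤n⊔m)
open import Data.Fin as Fin using (Fin; zero; suc; toℕ; fromℕ; inject₁)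
open import Data.Fin.Properties using (toℕ≤pred[n]; toℕ-fromℕ; toℕ-inject≤; toℕ<n)
open import Data.Vec using (Vec; []; _∷_; lookup; fromList; toList; tabulate; _++_)
open import Data.Vec.Properties using (lookup∘tabulate; tabulate∘lookup)
import Data.Vec.Relation.Unary.All as VecAll
open import Data.Vec.Relation.Unary.All.Properties using (lookup⁺; ++⁺; fromList⁺; toList⁺)
open import Data.List using (List; []; _∷_; length) renaming (_++_ to _++ˡ_; [_] to [_]ˡ; lookup to lookupˡ)
open import Data.List.Relation.Unary.All as All using (All; []; _∷_)
import Data.List.Relation.Unary.All.Properties as AllP
open import Data.List.Relation.Unary.Any using (here; index)
open import Data.List.Relation.Unary.Any.Properties using (lookup-index)
open import Data.List.Membership.Propositional using (_∈_; find)
open import Data.List.Membership.Propositional.Properties using (∈-++⁺ˡ; ∈-++⁺ʳ; ∈-lookup)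
open import Data.List.Relation.Binary.Subset.Propositional using (_⊆_)
open import Data.List.Relation.Binary.Subset.Propositional.Properties
  using (⊆-trans; xs⊆xs++ys; xs⊆ys++xs; xs⊆x∷xs; ∈-∷⁺ʳ; All-resp-⊇) renaming (++⁺ʳ to ++-⊆⁺ʳ)
open import Data.Product using (Σ; ∃; ∃₂; _×_; _,_; proj₁; proj₂)
open import Data.Product.Function.NonDependent.Propositional using (_×-⇔_)
open import Data.Sum using (_⊎_; inj₁; inj₂)
open import Data.Sum.Function.Propositional using (_⊎-⇔_)
open import Data.Unit using (⊤; tt)
open import Data.Empty using (⊥-elim)
open import Relation.Nullary using (¬_; Dec; yes; no)
open import Relation.Binary.PropositionalEquality
  using (_≡_; _≗_; refl; sym; trans; cong; cong₂; subst)
open import Function using (_⇔_; _∘_; mk⇔; Equivalence)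
open import Function.Definitions using (Injective)
open import Function.Properties.Equivalence using () renaming (refl to ⇔-refl; sym to ⇔-sym; trans to ⇔-trans)
open import Function.Related.TypeIsomorphisms using (→-cong-⇔; ¬-cong-⇔)

open Equivalence using (to; from)

∀-cong-⇔ : ∀ {a b c} {A : Set a} {B : A → Set b} {C : A → Set c} →
           (∀ x → B x ⇔ C x) → (∀ x → B x) ⇔ (∀ x → C x)
∀-cong-⇔ B⇔C = mk⇔ (λ f x → to (B⇔C x) (f x)) (λ f x → from (B⇔C x) (f x))

∃-cong-⇔ : ∀ {a b c} {A : Set a} {B : A → Set b} {C : A → Set c} →
           (∀ x → B x ⇔ C x) → (∃ B) ⇔ (∃ C)
∃-cong-⇔ B⇔C = mk⇔ (λ (x , b) → x , to (B⇔C x) b) (λ (x , c) → x , from (B⇔C x) c)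

split-∈ : ∀ {A : Set} {P : A → Set} {d : List A} (xs : List A) →
          All (λ y → P y ⊎ y ∈ d) xs → ∃ λ ys → All P ys × xs ⊆ d ++ˡ ys
split-∈ [] [] = [] , [] , λ ()
split-∈ {d = d} (x ∷ xs) (inj₁ px ∷ h) with split-∈ xs h
... | ys , pys , xs⊆ = x ∷ ys , px ∷ pys ,
      ∈-∷⁺ʳ (∈-++⁺ʳ d (here refl)) (⊆-trans xs⊆ (++-⊆⁺ʳ d (xs⊆x∷xs ys x)))
split-∈ (x ∷ xs) (inj₂ x∈d ∷ h) with split-∈ xs h
... | ys , pys , xs⊆ = ys , pys , ∈-∷⁺ʳ (∈-++⁺ˡ x∈d) xs⊆

module Semantics {L : Language} (N : Structure L) where
  open Language L
  open Structure N

  extend-≗ : ∀ {n} {ρ τ : Fin n → Carrier} x → ρ ≗ τ → extend N x ρ ≗ extend N x τ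
  extend-≗ x ρ≗τ zero    = refl
  extend-≗ x ρ≗τ (suc i) = ρ≗τ i

  mutual
    eval-cong : ∀ {n} {ρ τ : Fin n → Carrier} → ρ ≗ τ → (t : Term L n) → eval N ρ t ≡ eval N τ t
    eval-cong ρ≗τ (var i)    = ρ≗τ i
    eval-cong ρ≗τ (app f ts) = cong (funI f) (evalVec-cong ρ≗τ ts)

    evalVec-cong : ∀ {n k} {ρ τ : Fin n → Carrier} → ρ ≗ τ →
                   (ts : Vec (Term L n) k) → evalVec N ρ ts ≡ evalVec N τ ts
    evalVec-cong ρ≗τ []       = refl
    evalVec-cong ρ≗τ (t ∷ ts) = cong₂ _∷_ (eval-cong ρ≗τ t) (evalVec-cong ρ≗τ ts)

  ≐-cong : ∀ {x y x′ y′ : Carrier} → x ≡ x′ → y ≡ y′ → (x ≡ y) ⇔ (x′ ≡ y′)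
  ≐-cong refl refl = ⇔-refl

  rel-cong : ∀ (R : Rel) {xs ys} → xs ≡ ys → relI R xs ⇔ relI R ys
  rel-cong R refl = ⇔-refl

  Sat-cong : ∀ {n} {ρ τ : Fin n → Carrier} → ρ ≗ τ → (φ : Formula L n) → Sat N φ ρ ⇔ Sat N φ τ
  Sat-cong ρ≗τ ⊤ᶠ         = ⇔-refl
  Sat-cong ρ≗τ ⊥ᶠ         = ⇔-refl
  Sat-cong ρ≗τ (s ≐ t)    = ≐-cong (eval-cong ρ≗τ s) (eval-cong ρ≗τ t)
  Sat-cong ρ≗τ (rel R ts) = rel-cong R (evalVec-cong ρ≗τ ts)
  Sat-cong ρ≗τ (¬ᶠ φ)     = ¬-cong-⇔ (Sat-cong ρ≗τ φ)
  Sat-cong ρ≗τ (φ ∧ᶠ ψ)   = Sat-cong ρ≗τ φ ×-⇔ Sat-cong ρ≗τ ψ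
  Sat-cong ρ≗τ (φ ∨ᶠ ψ)   = Sat-cong ρ≗τ φ ⊎-⇔ Sat-cong ρ≗τ ψ
  Sat-cong ρ≗τ (φ ⇒ᶠ ψ)   = →-cong-⇔ (Sat-cong ρ≗τ φ) (Sat-cong ρ≗τ ψ)
  Sat-cong ρ≗τ (∀ᶠ φ)     = ∀-cong-⇔ λ x → Sat-cong (extend-≗ x ρ≗τ) φ
  Sat-cong ρ≗τ (∃ᶠ φ)     = ∃-cong-⇔ λ x → Sat-cong (extend-≗ x ρ≗τ) φ

  mutual
    renameTerm : ∀ {n m} → (Fin n → Fin m) → Term L n → Term L m
    renameTerm π (var i)    = var (π i)
    renameTerm π (app f ts) = app f (renameTerms π ts)

    renameTerms : ∀ {n m k} → (Fin n → Fin m) → Vec (Term L n) k → Vec (Term L m) k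
    renameTerms π []       = []
    renameTerms π (t ∷ ts) = renameTerm π t ∷ renameTerms π ts

  rename : ∀ {n m} → (Fin n → Fin m) → Formula L n → Formula L m
  rename π ⊤ᶠ         = ⊤ᶠ
  rename π ⊥ᶠ         = ⊥ᶠ
  rename π (s ≐ t)    = renameTerm π s ≐ renameTerm π t
  rename π (rel R ts) = rel R (renameTerms π ts)
  rename π (¬ᶠ φ)     = ¬ᶠ rename π φ
  rename π (φ ∧ᶠ ψ)   = rename π φ ∧ᶠ rename π ψ
  rename π (φ ∨ᶠ ψ)   = rename π φ ∨ᶠ rename π ψ
  rename π (φ ⇒ᶠ ψ)   = rename π φ ⇒ᶠ rename π ψ
  rename π (∀ᶠ φ)     = ∀ᶠ (rename (Fin.lift 1 π) φ)
  rename π (∃ᶠ φ)     = ∃ᶠ (rename (Fin.lift 1 π) φ)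

  mutual
    eval-rename : ∀ {n m} (π : Fin n → Fin m) (τ : Fin m → Carrier) (t : Term L n) →
                  eval N τ (renameTerm π t) ≡ eval N (τ ∘ π) t
    eval-rename π τ (var i)    = refl
    eval-rename π τ (app f ts) = cong (funI f) (evalVec-rename π τ ts)

    evalVec-rename : ∀ {n m k} (π : Fin n → Fin m) (τ : Fin m → Carrier) (ts : Vec (Term L n) k) →
                     evalVec N τ (renameTerms π ts) ≡ evalVec N (τ ∘ π) ts
    evalVec-rename π τ []       = refl
    evalVec-rename π τ (t ∷ ts) = cong₂ _∷_ (eval-rename π τ t) (evalVec-rename π τ ts)

  extend-lift : ∀ {n m} (π : Fin n → Fin m) (τ : Fin m → Carrier) x →
                extend N x τ ∘ Fin.lift 1 π ≗ extend N x (τ ∘ π)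
  extend-lift π τ x zero    = refl
  extend-lift π τ x (suc i) = refl

  Sat-rename : ∀ {n m} (π : Fin n → Fin m) (τ : Fin m → Carrier) (φ : Formula L n) →
               Sat N (rename π φ) τ ⇔ Sat N φ (τ ∘ π)
  Sat-rename π τ ⊤ᶠ         = ⇔-refl
  Sat-rename π τ ⊥ᶠ         = ⇔-refl
  Sat-rename π τ (s ≐ t)    = ≐-cong (eval-rename π τ s) (eval-rename π τ t)
  Sat-rename π τ (rel R ts) = rel-cong R (evalVec-rename π τ ts)
  Sat-rename π τ (¬ᶠ φ)     = ¬-cong-⇔ (Sat-rename π τ φ)
  Sat-rename π τ (φ ∧ᶠ ψ)   = Sat-rename π τ φ ×-⇔ Sat-rename π τ ψ
  Sat-rename π τ (φ ∨ᶠ ψ)   = Sat-rename π τ φ ⊎-⇔ Sat-rename π τ ψ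
  Sat-rename π τ (φ ⇒ᶠ ψ)   = →-cong-⇔ (Sat-rename π τ φ) (Sat-rename π τ ψ)
  Sat-rename π τ (∀ᶠ φ)     = ∀-cong-⇔ λ x →
    ⇔-trans (Sat-rename (Fin.lift 1 π) (extend N x τ) φ) (Sat-cong (extend-lift π τ x) φ)
  Sat-rename π τ (∃ᶠ φ)     = ∃-cong-⇔ λ x →
    ⇔-trans (Sat-rename (Fin.lift 1 π) (extend N x τ) φ) (Sat-cong (extend-lift π τ x) φ)

  Isolates : ∀ {n} → Formula L n → Set
  Isolates {n} φ = ∀ (ψ : Formula L n) →
    (∀ ρ → Sat N φ ρ → Sat N ψ ρ) ⊎ (∀ ρ → Sat N φ ρ → ¬ Sat N ψ ρ)

  isolated-type : ∀ {n} {φ : Formula L n} {ρ τ} → Isolates φ → Sat N φ ρ → Sat N φ τ →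
                  ∀ ψ → Sat N ψ ρ ⇔ Sat N ψ τ
  isolated-type iso φρ φτ ψ with iso ψ
  ... | inj₁ φ⇒ψ  = mk⇔ (λ _ → φ⇒ψ _ φτ) (λ _ → φ⇒ψ _ φρ)
  ... | inj₂ φ⇒¬ψ = mk⇔ (λ ψρ → ⊥-elim (φ⇒¬ψ _ φρ ψρ)) (λ ψτ → ⊥-elim (φ⇒¬ψ _ φτ ψτ))

  atomic-isolates : Atomic N → ∀ {n} (ρ : Fin n → Carrier) →
                    Σ (Formula L n) λ φ → Sat N φ ρ × Isolates φ
  atomic-isolates atom ρ with atom (tabulate ρ)
  ... | φ , φρ , iso = φ , to (Sat-cong (lookup∘tabulate ρ) φ) φρ , iso

  ∃ᶠ^ : ∀ k {m} → Formula L (k + m) → Formula L m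
  ∃ᶠ^ zero    φ = φ
  ∃ᶠ^ (suc k) φ = ∃ᶠ^ k (∃ᶠ φ)

  extend-lookup : ∀ {m} x (v : Vec Carrier m) → extend N x (lookup v) ≗ lookup (x ∷ v)
  extend-lookup x v zero    = refl
  extend-lookup x v (suc i) = refl

  ∃ᶠ^-intro : ∀ {k m} (v : Vec Carrier k) (w : Vec Carrier m) (φ : Formula L (k + m)) →
              Sat N φ (lookup (v ++ w)) → Sat N (∃ᶠ^ k φ) (lookup w)
  ∃ᶠ^-intro []      w φ φvw = φvw
  ∃ᶠ^-intro (x ∷ v) w φ φxvw =
    ∃ᶠ^-intro v w (∃ᶠ φ) (x , from (Sat-cong (extend-lookup x (v ++ w)) φ) φxvw)

  TarskiVaught : Subset N → Set
  TarskiVaught P = ∀ {n} (φ : Formula L (suc n)) (ρ : Fin n → Carrier) → (∀ i → P (ρ i)) →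
                   Sat N (∃ᶠ φ) ρ → Σ Carrier λ x → P x × Sat N φ (extend N x ρ)

  proj₁-extend : ∀ {M} (cl : Closed N M) {n} (ρ : Fin n → Σ Carrier M) x →
                 proj₁ ∘ extend (induced N M cl) x ρ ≗ extend N (proj₁ x) (proj₁ ∘ ρ)
  proj₁-extend cl ρ x zero    = refl
  proj₁-extend cl ρ x (suc i) = refl

  Elementary⇒TarskiVaught : ∀ {M} → Elementary N M → TarskiVaught M
  Elementary⇒TarskiVaught {M} E φ ρ ρ∈M ∃φ =
    let x , φx = from (elem (∃ᶠ φ) ρM) ∃φ in
    proj₁ x , proj₂ x , to (Sat-cong (proj₁-extend closed ρM x) φ) (to (elem φ _) φx)
    where
      open Elementary E
      ρM : Fin _ → Σ Carrier M
      ρM i = ρ i , ρ∈M i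

  ∃ᶠ^-elim : ∀ {P k m} → TarskiVaught P → (φ : Formula L (k + m)) {w : Vec Carrier m} →
             VecAll.All P w → Sat N (∃ᶠ^ k φ) (lookup w) →
             Σ (Vec Carrier k) λ v → VecAll.All P v × Sat N φ (lookup (v ++ w))
  ∃ᶠ^-elim {k = zero}  tv φ w∈P φw = [] , VecAll.[] , φw
  ∃ᶠ^-elim {k = suc k} tv φ {w} w∈P ∃φ with ∃ᶠ^-elim tv (∃ᶠ φ) w∈P ∃φ
  ... | v , v∈P , ∃φvw with tv φ (lookup (v ++ w)) (lookup⁺ (++⁺ v∈P w∈P)) ∃φvw
  ...   | x , x∈P , φxvw = x ∷ v , x∈P VecAll.∷ v∈P , to (Sat-cong (extend-lookup x (v ++ w)) φ) φxvw

  evalVec-tabulate : ∀ {n k} (ρ : Fin n → Carrier) (g : Fin k → Fin n) →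
                     evalVec N ρ (tabulate (var ∘ g)) ≡ tabulate (ρ ∘ g)
  evalVec-tabulate {k = zero}  ρ g = refl
  evalVec-tabulate {k = suc k} ρ g = cong (ρ (g zero) ∷_) (evalVec-tabulate ρ (g ∘ suc))

  -- Closure under f is Tarski–Vaught for the formula x₀ ≐ f(x₁, …, xₖ).
  TarskiVaught⇒Closed : ∀ {P} → TarskiVaught P → Closed N P
  TarskiVaught⇒Closed {P} tv f xs xs∈P =
    let z , z∈P , z≡ = tv φ (lookup xs) xs∈P (funI f xs , sym (fx≡ _)) in
    subst P (trans z≡ (fx≡ z)) z∈P
    where
      φ : Formula L (suc (funAr f))
      φ = var zero ≐ app f (tabulate (var ∘ suc))
      fx≡ : ∀ z → funI f (evalVec N (extend N z (lookup xs)) (tabulate (var ∘ suc))) ≡ funI f xs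
      fx≡ z = cong (funI f) (trans (evalVec-tabulate _ suc) (tabulate∘lookup xs))

module Classical (lem : ExcludedMiddle (Level.suc 0ℓ)) {L : Language} (N : Structure L) where
  open Language L
  open Structure N
  open Semantics N

  decide : (P : Set) → Dec P
  decide P with lem {Lift (Level.suc 0ℓ) P}
  ... | yes (lift p) = yes p
  ... | no ¬p        = no (λ p → ¬p (lift p))

  module TarskiVaughtTest {P : Subset N} (propP : PropSubset N P) (tv : TarskiVaught P) where
    closedP : Closed N P
    closedP = TarskiVaught⇒Closed tv

    P* : Structure L
    P* = induced N P closedP

    mutual
      eval-induced : ∀ {n} (ρ : Fin n → Σ Carrier P) (t : Term L n) →
                     proj₁ (eval P* ρ t) ≡ eval N (proj₁ ∘ ρ) t
      eval-induced ρ (var i)    = refl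
      eval-induced ρ (app f ts) = cong (funI f) (evalVec-induced ρ ts)

      evalVec-induced : ∀ {n k} (ρ : Fin n → Σ Carrier P) (ts : Vec (Term L n) k) →
                        liftVec N P (evalVec P* ρ ts) ≡ evalVec N (proj₁ ∘ ρ) ts
      evalVec-induced ρ []       = refl
      evalVec-induced ρ (t ∷ ts) = cong₂ _∷_ (eval-induced ρ t) (evalVec-induced ρ ts)

    Σ-≡ : {u v : Σ Carrier P} → proj₁ u ≡ proj₁ v → u ≡ v
    Σ-≡ {x , p} {.x , q} refl = cong (x ,_) (propP x p q)

    Sat-extend : ∀ {n} (φ : Formula L (suc n)) (ρ : Fin n → Σ Carrier P) x →
                 Sat N φ (proj₁ ∘ extend P* x ρ) ⇔ Sat N φ (extend N (proj₁ x) (proj₁ ∘ ρ))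
    Sat-extend φ ρ x = Sat-cong (proj₁-extend closedP ρ x) φ

    witness : ∀ {n} (φ : Formula L (suc n)) (ρ : Fin n → Σ Carrier P) →
              Sat N (∃ᶠ φ) (proj₁ ∘ ρ) →
              Σ (Σ Carrier P) λ x → Sat N φ (extend N (proj₁ x) (proj₁ ∘ ρ))
    witness φ ρ ∃φ with tv φ (proj₁ ∘ ρ) (proj₂ ∘ ρ) ∃φ
    ... | x , x∈P , φx = (x , x∈P) , φx

    elementary-⇔ : ∀ {n} (φ : Formula L n) (ρ : Fin n → Σ Carrier P) →
                   Sat P* φ ρ ⇔ Sat N φ (proj₁ ∘ ρ)
    elementary-⇔ ⊤ᶠ         ρ = ⇔-refl
    elementary-⇔ ⊥ᶠ         ρ = ⇔-refl
    elementary-⇔ (s ≐ t)    ρ = mk⇔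
      (λ s≡t → trans (sym (eval-induced ρ s)) (trans (cong proj₁ s≡t) (eval-induced ρ t)))
      (λ s≡t → Σ-≡ (trans (eval-induced ρ s) (trans s≡t (sym (eval-induced ρ t)))))
    elementary-⇔ (rel R ts) ρ = rel-cong R (evalVec-induced ρ ts)
    elementary-⇔ (¬ᶠ φ)     ρ = ¬-cong-⇔ (elementary-⇔ φ ρ)
    elementary-⇔ (φ ∧ᶠ ψ)   ρ = elementary-⇔ φ ρ ×-⇔ elementary-⇔ ψ ρ
    elementary-⇔ (φ ∨ᶠ ψ)   ρ = elementary-⇔ φ ρ ⊎-⇔ elementary-⇔ ψ ρ
    elementary-⇔ (φ ⇒ᶠ ψ)   ρ = →-cong-⇔ (elementary-⇔ φ ρ) (elementary-⇔ ψ ρ)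
    elementary-⇔ (∃ᶠ φ)     ρ = mk⇔
      (λ (x , φx) → proj₁ x , to (Sat-extend φ ρ x) (to (elementary-⇔ φ (extend P* x ρ)) φx))
      (λ ∃φ → let x , φx = witness φ ρ ∃φ in
              x , from (elementary-⇔ φ (extend P* x ρ)) (from (Sat-extend φ ρ x) φx))
    elementary-⇔ (∀ᶠ φ)     ρ = mk⇔ ∀-down
      (λ ∀φ x → from (elementary-⇔ φ (extend P* x ρ)) (from (Sat-extend φ ρ x) (∀φ (proj₁ x))))
      where
        -- a counterexample in N would have one in P, by Tarski–Vaught for ¬ φ
        ∀-down : Sat P* (∀ᶠ φ) ρ → Sat N (∀ᶠ φ) (proj₁ ∘ ρ)
        ∀-down ∀φ y with decide (Sat N φ (extend N y (proj₁ ∘ ρ)))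
        ... | yes φy = φy
        ... | no ¬φy =
          let x , ¬φx = witness (¬ᶠ φ) ρ (y , ¬φy) in
          ⊥-elim (¬φx (to (Sat-extend φ ρ x) (to (elementary-⇔ φ (extend P* x ρ)) (∀φ x))))

    tarskiVaught-elementary : Elementary N P
    tarskiVaught-elementary = record
      { propM = propP ; closed = closedP ; elem = elementary-⇔ }

  open TarskiVaughtTest using (tarskiVaught-elementary) public

  full-elementary : Elementary N (λ _ → ⊤)
  full-elementary = tarskiVaught-elementary (λ { x tt tt → refl }) (λ φ ρ _ (x , φx) → x , tt , φx)

  module ElementaryImage (σ : Carrier → Carrier)
           (σ-elementary : ∀ {n} (φ : Formula L n) (ρ : Fin n → Carrier) →
                           Sat N φ ρ ⇔ Sat N φ (σ ∘ ρ)) where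

    σ-injective : Injective _≡_ _≡_ σ
    σ-injective {x} {y} = from (σ-elementary (var zero ≐ var (suc zero)) xy)
      where
        xy : Fin 2 → Carrier
        xy zero       = x
        xy (suc zero) = y

    image : Subset N → Subset N
    image M y = ∃ λ x → M x × σ x ≡ y

    image-elementary : ∀ {M} → Elementary N M → Elementary N (image M)
    image-elementary {M} E = tarskiVaught-elementary propImage tvImage
      where
        open Elementary E using (propM)

        propImage : PropSubset N (image M)
        propImage y (x , p , σx≡y) (x′ , p′ , σx′≡y) =
          same (σ-injective (trans σx≡y (sym σx′≡y))) p p′ σx≡y σx′≡y
          where
            same : x ≡ x′ → ∀ p p′ (e : σ x ≡ y) (e′ : σ x′ ≡ y) →
                   _≡_ {A = image M y} (x , p , e) (x′ , p′ , e′)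
            same refl p p′ e e′ with propM x p p′ | uip e e′
            ... | refl | refl = refl

        tvImage : TarskiVaught (image M)
        tvImage φ ρ ρ∈ ∃φ =
          let w , w∈M , φw = Elementary⇒TarskiVaught E φ ρ₀ (λ i → proj₁ (proj₂ (ρ∈ i)))
                               (from (σ-elementary (∃ᶠ φ) ρ₀) (from (Sat-cong σρ₀≗ρ (∃ᶠ φ)) ∃φ))
          in σ w , (w , w∈M , refl) , to (Sat-cong (σ-extend w) φ) (to (σ-elementary φ _) φw)
          where
            ρ₀ : Fin _ → Carrier
            ρ₀ i = proj₁ (ρ∈ i)
            σρ₀≗ρ : σ ∘ ρ₀ ≗ ρ
            σρ₀≗ρ i = proj₂ (proj₂ (ρ∈ i))
            σ-extend : ∀ w → σ ∘ extend N w ρ₀ ≗ extend N (σ w) ρ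
            σ-extend w zero    = refl
            σ-extend w (suc i) = σρ₀≗ρ i

  ¬Pcl⇒escape : ∀ {c b} → ¬ Pcl N c b →
                Σ (Subset N) λ M → Elementary N M × All M b × ∃ λ x → x ∈ c × ¬ M x
  ¬Pcl⇒escape {c} {b} ¬pcl with lem {Σ (Subset N) λ M → Elementary N M × All M b × ¬ All M c}
  ... | yes (M , E , b∈M , ¬c⊆M) = M , E , b∈M , find (AllP.¬All⇒Any¬ (λ x → decide (M x)) c ¬c⊆M)
  ... | no ¬escape = ⊥-elim (¬pcl λ M E b∈M → stay M E b∈M)
    where
      stay : ∀ M → Elementary N M → All M b → All M c
      stay M E b∈M with decide (All M c)
      ... | yes c∈M = c∈M
      ... | no ¬c∈M = ⊥-elim (¬escape (M , E , b∈M , ¬c∈M))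

-- A forth-only construction enumerating N along an injection into ℕ.
module ElementaryEmbedding (lem : ExcludedMiddle (Level.suc 0ℓ)) {L : Language} (N : Structure L)
         (cnt : Countable N) (atom : Atomic N)
         (M₀ : Subset N) (E₀ : Elementary N M₀) (T : List (Structure.Carrier N)) (T∈M₀ : All M₀ T) where
  open Language L
  open Structure N
  open Semantics N
  open Classical lem N

  code : Carrier → ℕ
  code = proj₁ cnt

  record FiniteElementaryMap : Set where
    field
      size      : ℕ
      dom cod   : Fin size → Carrier
      cod∈M₀    : ∀ i → M₀ (cod i)
      preserves : ∀ (φ : Formula L size) → Sat N φ dom ⇔ Sat N φ cod
  open FiniteElementaryMap

  identityOnT : FiniteElementaryMap
  identityOnT = record
    { size = length T ; dom = lookupˡ T ; cod = lookupˡ T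
    ; cod∈M₀ = λ i → All.lookup T∈M₀ (∈-lookup i) ; preserves = λ _ → ⇔-refl }

  -- y realises over cod the type of x over dom: it is isolated, and M₀ ⪯ N.
  extendBy : FiniteElementaryMap → Carrier → FiniteElementaryMap
  extendBy f x with atomic-isolates atom (extend N x (dom f))
  ... | φ , φx , iso
      with Elementary⇒TarskiVaught E₀ φ (cod f) (cod∈M₀ f) (to (preserves f (∃ᶠ φ)) (x , φx))
  ...   | y , y∈M₀ , φy = record
    { size = suc (size f) ; dom = extend N x (dom f) ; cod = extend N y (cod f)
    ; cod∈M₀ = λ { zero → y∈M₀ ; (suc i) → cod∈M₀ f i }
    ; preserves = isolated-type {φ = φ} iso φx φy }

  stage : ℕ → FiniteElementaryMap
  stage zero = identityOnT
  stage (suc s) with decide (∃ λ x → code x ≡ s)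
  ... | yes (x , _) = extendBy (stage s) x
  ... | no _        = stage s

  Sends : FiniteElementaryMap → Carrier → Carrier → Set
  Sends f x y = ∃ λ i → dom f i ≡ x × cod f i ≡ y

  Sends-suc : ∀ s {x y} → Sends (stage s) x y → Sends (stage (suc s)) x y
  Sends-suc s (i , e) with decide (∃ λ x → code x ≡ s)
  ... | yes _ = suc i , e
  ... | no _  = i , e

  Sends-≤′ : ∀ {s t x y} → s ≤′ t → Sends (stage s) x y → Sends (stage t) x y
  Sends-≤′ (≤′-reflexive refl) sends = sends
  Sends-≤′ (≤′-step {t} s≤′t) sends = Sends-suc t (Sends-≤′ s≤′t sends)

  Sends-functional : ∀ f {x y y′} → Sends f x y → Sends f x y′ → y ≡ y′
  Sends-functional f (i , refl , refl) (j , xj , refl) = to (preserves f (var i ≐ var j)) (sym xj)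

  sentAtCode : ∀ x → ∃ λ y → Sends (stage (suc (code x))) x y
  sentAtCode x with decide (∃ λ z → code z ≡ code x)
  ... | yes (z , cz≡cx) = _ , zero , proj₂ cnt cz≡cx , refl
  ... | no ∄z           = ⊥-elim (∄z (x , refl))

  σ : Carrier → Carrier
  σ x = proj₁ (sentAtCode x)

  Sends-σ : ∀ {s} x → suc (code x) ≤ s → Sends (stage s) x (σ x)
  Sends-σ x le = Sends-≤′ (≤⇒≤′ le) (proj₂ (sentAtCode x))

  σ∈M₀ : ∀ x → M₀ (σ x)
  σ∈M₀ x with sentAtCode x
  ... | _ , i , _ , refl = cod∈M₀ (stage (suc (code x))) i

  σ-fixes : ∀ {t} → t ∈ T → σ t ≡ t
  σ-fixes {t} t∈T = Sends-functional (stage (suc (code t))) (proj₂ (sentAtCode t))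
    (Sends-≤′ {s = 0} {t = suc (code t)} (≤⇒≤′ z≤n) (index t∈T , t≡ , t≡))
    where
      t≡ : lookupˡ T (index t∈T) ≡ t
      t≡ = sym (lookup-index t∈T)

  codeBound : ∀ {n} → (Fin n → Carrier) → ℕ
  codeBound {zero}  ρ = 0
  codeBound {suc n} ρ = code (ρ zero) ⊔ codeBound (ρ ∘ suc)

  code≤codeBound : ∀ {n} (ρ : Fin n → Carrier) i → code (ρ i) ≤ codeBound ρ
  code≤codeBound ρ zero    = m≤m⊔n _ _
  code≤codeBound ρ (suc i) = ≤-trans (code≤codeBound (ρ ∘ suc) i) (m≤n⊔m _ _)

  -- All of ρ is sent at one stage; rename φ into that stage's variables.
  σ-elementary : ∀ {n} (φ : Formula L n) (ρ : Fin n → Carrier) → Sat N φ ρ ⇔ Sat N φ (σ ∘ ρ)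
  σ-elementary φ ρ =
    ⇔-trans (Sat-cong (λ i → sym (proj₁ (proj₂ (sends i)))) φ)
    (⇔-trans (⇔-sym (Sat-rename π (dom f) φ))
    (⇔-trans (preserves f (rename π φ))
    (⇔-trans (Sat-rename π (cod f) φ)
             (Sat-cong (λ i → proj₂ (proj₂ (sends i))) φ))))
    where
      f = stage (suc (codeBound ρ))
      sends : ∀ i → Sends f (ρ i) (σ (ρ i))
      sends i = Sends-σ (ρ i) (s≤s (code≤codeBound ρ i))
      π = λ i → proj₁ (sends i)

  open ElementaryImage σ σ-elementary public

  image⊆M₀ : ∀ {M} y → image M y → M₀ y
  image⊆M₀ y (x , _ , σx≡y) = subst M₀ σx≡y (σ∈M₀ x)

  image-∋ : ∀ {M t} → t ∈ T → M t → image M t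
  image-∋ t∈T t∈M = _ , t∈M , σ-fixes t∈T

  image-∌ : ∀ {M t} → t ∈ T → ¬ M t → ¬ image M t
  image-∌ {M} t∈T t∉M (x , x∈M , σx≡t) =
    t∉M (subst M (σ-injective (trans σx≡t (sym (σ-fixes t∈T)))) x∈M)

module Chains (lem : ExcludedMiddle (Level.suc 0ℓ)) {L : Language} (N : Structure L)
              (cnt : Countable N) (atom : Atomic N) where
  open Language L
  open Structure N
  open Semantics N
  open Classical lem N

  Pcl-mono : ∀ {c b X} → b ⊆ X → Pcl N c b → Pcl N c X
  Pcl-mono b⊆X pcl M E X∈M = pcl M E (All-resp-⊇ b⊆X X∈M)

  Pcl-∈ : ∀ {x c X} → x ∈ c → Pcl N c X → Pcl N [ x ]ˡ X
  Pcl-∈ x∈c pcl M E X∈M = All.lookup (pcl M E X∈M) x∈c ∷ []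

  realise-type : ∀ {M} → Elementary N M → ∀ {a} → All M a → ∀ {k} (e : Vec Carrier k) →
                 ∃ λ (a′ : Vec Carrier k) → VecAll.All M a′ × SameType N a′ e a
  realise-type E {a} a∈M {k} e with atom (e ++ fromList a)
  ... | φ , φea , iso
      with ∃ᶠ^-elim (Elementary⇒TarskiVaught E) φ (fromList⁺ a∈M) (∃ᶠ^-intro e (fromList a) φ φea)
  ...   | a′ , a′∈M , φa′a = a′ , a′∈M , isolated-type {φ = φ} iso φa′a φea

  bottom : ∀ {n d a} → GoodChain N n d a → Subset N
  bottom (Ms , _) = Ms zero

  trivialChain : ∀ {d a} → GoodChain N 0 d a
  trivialChain = (λ _ _ → ⊤) , (λ _ → full-elementary) , (λ ()) , (λ _ → tt) ,
                 All.tabulate (λ _ → tt) , (λ ())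

  GoodChain-cons : ∀ {m d a₀ a} (g : GoodChain N m d a₀) {M} → Elementary N M →
                   (∀ x → M x → bottom g x) → All M a →
                   (∃ λ e → PclSet N M d e × bottom g e × ¬ M e) → GoodChain N (suc m) d a
  GoodChain-cons {d = d} (Ms , el , inc , top , _ , pcls) {M} E M⊆ a∈M new =
    Ms′ , el′ , inc′ , top , a∈M , pcls′
    where
      Ms′ : Fin _ → Subset N
      Ms′ zero    = M
      Ms′ (suc i) = Ms i
      el′ : ∀ i → Elementary N (Ms′ i)
      el′ zero    = E
      el′ (suc i) = el i
      inc′ : ∀ i x → Ms′ (inject₁ i) x → Ms′ (suc i) x
      inc′ zero    = M⊆
      inc′ (suc i) = inc i
      pcls′ : ∀ i → ∃ λ e → PclSet N (Ms′ (inject₁ i)) d e × Ms′ (suc i) e × ¬ Ms′ (inject₁ i) e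
      pcls′ zero    = new
      pcls′ (suc i) = pcls i

  GoodChain-tail : ∀ {m d a a′} (g : GoodChain N (suc m) d a) →
                   All (proj₁ g (suc zero)) a′ → GoodChain N m d a′
  GoodChain-tail (Ms , el , inc , top , _ , pcls) a′∈M₁ =
    (Ms ∘ suc) , (el ∘ suc) , (inc ∘ suc) , top , a′∈M₁ , (pcls ∘ suc)

  GoodChain-cast : ∀ {j j′ d a} → j ≡ j′ → GoodChain N j d a → GoodChain N j′ d a
  GoodChain-cast refl g = g

  GoodChain-≤′ : ∀ {j n d a} → j ≤′ n → GoodChain N n d a → GoodChain N j d a
  GoodChain-≤′ (≤′-reflexive refl) g = g
  GoodChain-≤′ (≤′-step j≤′n) g@(_ , _ , inc , _ , a∈M₀ , _) =
    GoodChain-≤′ j≤′n (GoodChain-tail g (All.map (inc zero _) a∈M₀))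

  GoodChain-extend : ∀ {m d a b c} → GoodChain N m d (a ++ˡ b ++ˡ c) →
                     Pcl N c (d ++ˡ a ++ˡ b) → ¬ Pcl N c (a ++ˡ b) → GoodChain N (suc m) d a
  GoodChain-extend {d = d} {a} {b} {c} g@(_ , el , _ , _ , abc∈M₀ , _) pcl ¬pcl
    with ¬Pcl⇒escape ¬pcl
  ... | M , E , ab∈M , x , x∈c , x∉M =
    GoodChain-cons g (image-elementary E) image⊆M₀ (All-resp-⊇ (xs⊆xs++ys a b) ab∈M′)
      (x , (d ++ˡ a ++ˡ b , dab∈ , Pcl-∈ x∈c pcl) , All.lookup abc∈M₀ x∈abc , image-∌ x∈abc x∉M)
    where
      open ElementaryEmbedding lem N cnt atom (bottom g) (el zero) (a ++ˡ b ++ˡ c) abc∈M₀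
      ab⊆abc : a ++ˡ b ⊆ a ++ˡ b ++ˡ c
      ab⊆abc = ++-⊆⁺ʳ a (xs⊆xs++ys b c)
      x∈abc : x ∈ a ++ˡ b ++ˡ c
      x∈abc = ∈-++⁺ʳ a (∈-++⁺ʳ b x∈c)
      ab∈M′ : All (image M) (a ++ˡ b)
      ab∈M′ = All.tabulate (λ t∈ab → image-∋ (ab⊆abc t∈ab) (All.lookup ab∈M t∈ab))
      dab∈ : All (λ y → image M y ⊎ y ∈ d) (d ++ˡ a ++ˡ b)
      dab∈ = AllP.++⁺ (All.tabulate inj₂) (All.map inj₁ ab∈M′)

  StepWitness : (List Carrier → Set₁) → List Carrier → List Carrier → ∀ {k} → Vec Carrier k → Set₁
  StepWitness P d a {k} e =
    ∃ λ (a′ : Vec Carrier k) → ∃₂ λ (b c : List Carrier) →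
      SameType N a′ e a ×
      P (a ++ˡ toList a′ ++ˡ b ++ˡ c) ×
      Pcl N c (d ++ˡ a ++ˡ toList a′ ++ˡ b) ×
      ¬ Pcl N c (a ++ˡ toList a′ ++ˡ b)

  GoodChain-peel : ∀ {j d a} → GoodChain N (suc j) d a → ∀ {k} (e : Vec Carrier k) →
                   StepWitness (GoodChain N j d) d a e
  GoodChain-peel {d = d} {a} g@(Ms , el , inc , _ , a∈M₀ , pcls) e
    with realise-type (el zero) a∈M₀ e | pcls zero
  ... | a′ , a′∈M₀ , a′≡e | e₁ , (bb , bb∈ , pcl) , e₁∈M₁ , e₁∉M₀ with split-∈ bb bb∈
  ...   | b , b∈M₀ , bb⊆db =
    a′ , b , [ e₁ ]ˡ , a′≡e ,
    GoodChain-tail g (AllP.++⁺ (up a∈M₀) (AllP.++⁺ (up (toList⁺ a′∈M₀))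
                                         (AllP.++⁺ (up b∈M₀) (e₁∈M₁ ∷ [])))) ,
    Pcl-mono (⊆-trans bb⊆db (++-⊆⁺ʳ d b⊆aa′b)) pcl ,
    λ pcl₀ → e₁∉M₀ (All.head (pcl₀ (Ms zero) (el zero) aa′b∈M₀))
    where
      up : ∀ {xs} → All (Ms zero) xs → All (Ms (suc zero)) xs
      up = All.map (inc zero _)
      aa′b∈M₀ : All (Ms zero) (a ++ˡ toList a′ ++ˡ b)
      aa′b∈M₀ = AllP.++⁺ a∈M₀ (AllP.++⁺ (toList⁺ a′∈M₀) b∈M₀)
      b⊆aa′b : b ⊆ a ++ˡ toList a′ ++ˡ b
      b⊆aa′b = ⊆-trans (xs⊆ys++xs b (toList a′)) (xs⊆ys++xs _ a)

  RkStep⇒GoodChain : ∀ m {lower d a} → (∀ γ {d a} → lower γ d a → GoodChain N (toℕ γ) d a) →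
                     RkStep N m lower d a → GoodChain N m d a
  RkStep⇒GoodChain zero    lower⇒chain r = trivialChain
  RkStep⇒GoodChain (suc m) lower⇒chain r with r [] (fromℕ m)
  ... | [] , b , c , _ , lower , pcl , ¬pcl =
    GoodChain-extend (GoodChain-cast (toℕ-fromℕ m) (lower⇒chain (fromℕ m) lower)) pcl ¬pcl

  GoodChain⇒RkStep : ∀ m {lower d a} → (∀ γ {d a} → GoodChain N (toℕ γ) d a → lower γ d a) →
                     GoodChain N m d a → RkStep N m lower d a
  GoodChain⇒RkStep m chain⇒lower g e γ with GoodChain-peel (GoodChain-≤′ (≤⇒≤′ (toℕ<n γ)) g) e
  ... | a′ , b , c , a′≡e , g′ , pcl , ¬pcl = a′ , b , c , a′≡e , chain⇒lower γ g′ , pcl , ¬pcl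

  RkF⇒GoodChain : ∀ n (β : Fin n) {d a} → RkF N n β d a → GoodChain N (toℕ β) d a
  RkF⇒GoodChain (suc n) β = RkStep⇒GoodChain (toℕ β) λ γ r →
    GoodChain-cast (toℕ-inject≤ γ (toℕ≤pred[n] β)) (RkF⇒GoodChain n _ r)

  GoodChain⇒RkF : ∀ n (β : Fin n) {d a} → GoodChain N (toℕ β) d a → RkF N n β d a
  GoodChain⇒RkF (suc n) β = GoodChain⇒RkStep (toℕ β) λ γ g →
    GoodChain⇒RkF n _ (GoodChain-cast (sym (toℕ-inject≤ γ (toℕ≤pred[n] β))) g)

  Rk⇔GoodChain : ∀ n d a → Rk N n d a ⇔ GoodChain N n d a
  Rk⇔GoodChain n d a = mk⇔
    (GoodChain-cast (toℕ-fromℕ n) ∘ RkF⇒GoodChain (suc n) (fromℕ n))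
    (GoodChain⇒RkF (suc n) (fromℕ n) ∘ GoodChain-cast (sym (toℕ-fromℕ n)))

proposition3p6 : ExcludedMiddle (Level.suc 0ℓ) →
    (L : Language) (N : Structure L) →
    Countable N → Atomic N → ¬ Minimal N →
    ∀ (n : ℕ) (d a : List (Structure.Carrier N)) →
    Rk N n d a ⇔ GoodChain N n d a
proposition3p6 lem L N cnt atom _ = Chains.Rk⇔GoodChain lem N cnt atom
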